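{- For $n\ge 1$, the map $T\mapsto\hat T$ is a bijection from $\mathcal{T}_n$ onto the set of diagram-drawings of size $n$.
   Context: A binary tree is either a single leaf or a node with an ordered pair (left, right) of binary subtrees; its size is its number of nodes and $\mathcal{T}_n$ is the set of binary trees of size $n$. For $T\in\mathcal{T}_n$, label its nodes $v_1,\dots,v_n$ in infix (in-order) order and let $b_t(T)$ be the number of nodes in the left subtree of $v_t$. A diagram-drawing of size $n$ is a non-crossing arc-diagram on the points $0,\tfrac12,1,\dots,n$ of the horizontal axis, integer points black and half-integer points white, with all arcs in the upper half-plane, every arc having a black left end and a white right end, and every white point incident to exactly one arc. For $T\in\mathcal{T}_n$, $\hat T$ is the diagram-drawing having, for each $t\in[n]$, an arc from the white point $t-\tfrac12$ to the black point $t-1-b_t(T)$ (equivalently: in the drawing where every node $v$ is a semicircle joining the positions of the leftmost and rightmost leaves of its subtree, leaves at $0,\dots,n$, the arc at $t-\tfrac12$ goes to the left end of the innermost semicircle covering $[t-1,t]$). -}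

module Defs where

open import Data.Nat using (ℕ; zero; suc; _+_; _∸_; _≤_; _<_)
open import Data.List using (List; []; _∷_; _++_)
open import Data.Product using (_×_)
open import Relation.Nullary using (¬_)

data Tree : Set where
  leaf : Tree
  node : Tree → Tree → Tree

size : Tree → ℕ
size leaf       = 0
size (node l r) = size l + suc (size r)

-- The list (b_1, …, b_n): nodes in infix (in-order) order, each recorded by
-- the number of nodes of its left subtree.
leftSizes : Tree → List ℕ
leftSizes leaf       = []
leftSizes (node l r) = leftSizes l ++ (size l ∷ leftSizes r)

-- 0-based lookup with default 0 (only used at indices < length)
at : List ℕ → ℕ → ℕ
at []       _       = 0
at (x ∷ xs) zero    = x
at (x ∷ xs) (suc i) = at xs i

-- Arc data of a drawing of size n: white point i + 1/2 (i = 0,…,n-1)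
-- is joined to black point  f i.  Values of f at i ≥ n are irrelevant.
ArcFn : Set
ArcFn = ℕ → ℕ

-- f encodes a diagram-drawing of size n:
--  * each white point i+1/2 carries exactly one arc (encoded by f being a function),
--    whose left end is a black point f i and right end is the white point,
--    so f i < i + 1/2, i.e. f i ≤ i;
--  * non-crossing: for white points i < j, the arcs (f i, i+1/2) and
--    (f j, j+1/2) cross iff f i < f j < i + 1/2, i.e. f i < f j ≤ i.
IsDrawing : ℕ → ArcFn → Set
IsDrawing n f =
  (∀ i → i < n → f i ≤ i) ×
  (∀ i j → i < j → j < n → ¬ (f i < f j × f j ≤ i))

-- T̂ : the white point t - 1/2 (t = i + 1) is joined to t - 1 - b_t(T) = i - b_{i+1}(T).
hat : Tree → ArcFn
hat T i = i ∸ at (leftSizes T) i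

-- Both trees and drawings have a recursive "root" decomposition. For a node
-- with left subtree l, the white point size l + 1/2 is joined to 0, the arcs
-- of l sit below it, and those of the right subtree are shifted by size l + 1
-- to the right of it. Conversely, in a drawing of size m + 1 the last white
-- point joined to 0 plays the role of the root: every later arc has its
-- black end beyond that point (otherwise it would cross the arc to 0), so
-- the drawing splits into a drawing on the left and a shifted drawing on the
-- right. Both decompositions are unique, which gives the bijection by strong
-- induction on the size.
module Submission where

open import Defs
open import Data.Nat using (ℕ; zero; suc; _+_; _∸_; _≤_; _<_; z≤n; s≤s; s≤s⁻¹; z<s; s<s⁻¹; _≟_)
open import Data.Nat.Properties
open import Data.Nat.Induction using (<-rec)
open import Data.List using (List; []; _∷_; _++_; length)
open import Data.List.Properties using (length-++)
open import Data.Product using (Σ; ∃; ∃₂; _×_; _,_)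
open import Data.Sum using (inj₁; inj₂)
open import Function using (_∘_)
open import Relation.Nullary using (¬_; yes; no; contradiction)
open import Relation.Unary using (Decidable)
open import Relation.Binary.PropositionalEquality
  using (_≡_; _≢_; refl; sym; trans; cong; cong₂; subst; subst₂; module ≡-Reasoning)
open import Relation.Binary.Definitions using (tri<; tri≈; tri>)

data Split (a b : ℕ) : ℕ → Set where
  left  : ∀ {i} → i < a → Split a b i
  root  : Split a b a
  right : ∀ {k} → k < b → Split a b (a + suc k)

split : ∀ a b i → i < a + suc b → Split a b i
split zero    b zero    _       = root
split zero    b (suc i) (s≤s p) = right p
split (suc a) b zero    _       = left z<s
split (suc a) b (suc i) (s≤s p) with split a b i p
... | left q  = left (s≤s q)
... | root    = root
... | right q = right q

root<size : ∀ a b → a < a + suc b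
root<size a b = m<m+n a z<s

right-size<size : ∀ a b → b < a + suc b
right-size<size a b = <-≤-trans (n<1+n b) (m≤n+m (suc b) a)

right<size : ∀ a {b k} → k < b → a + suc k < a + suc b
right<size a k<b = +-monoʳ-< a (s≤s k<b)

at-++ˡ : ∀ (xs ys : List ℕ) {i} → i < length xs → at (xs ++ ys) i ≡ at xs i
at-++ˡ (x ∷ xs) ys {zero}  _       = refl
at-++ˡ (x ∷ xs) ys {suc i} (s≤s p) = at-++ˡ xs ys p

at-++ʳ : ∀ (xs ys : List ℕ) k → at (xs ++ ys) (length xs + k) ≡ at ys k
at-++ʳ []       ys k = refl
at-++ʳ (x ∷ xs) ys k = at-++ʳ xs ys k

length-leftSizes : ∀ T → length (leftSizes T) ≡ size T
length-leftSizes leaf       = refl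
length-leftSizes (node l r) = begin
  length (leftSizes l ++ size l ∷ leftSizes r)    ≡⟨ length-++ (leftSizes l) ⟩
  length (leftSizes l) + suc (length (leftSizes r)) ≡⟨ cong₂ (λ x y → x + suc y) (length-leftSizes l) (length-leftSizes r) ⟩
  size l + suc (size r)                           ∎
  where open ≡-Reasoning

at-leftSizes-node : ∀ l r k →
  at (leftSizes (node l r)) (size l + k) ≡ at (size l ∷ leftSizes r) k
at-leftSizes-node l r k =
  subst (λ s → at (leftSizes (node l r)) (s + k) ≡ at (size l ∷ leftSizes r) k)
        (length-leftSizes l) (at-++ʳ (leftSizes l) _ k)

at-leftSizes-left : ∀ l r {i} → i < size l → at (leftSizes (node l r)) i ≡ at (leftSizes l) i
at-leftSizes-left l r i<a =
  at-++ˡ (leftSizes l) _ (subst (_ <_) (sym (length-leftSizes l)) i<a)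

at-leftSizes-root : ∀ l r → at (leftSizes (node l r)) (size l) ≡ size l
at-leftSizes-root l r =
  subst (λ i → at (leftSizes (node l r)) i ≡ size l) (+-identityʳ (size l)) (at-leftSizes-node l r 0)

at-leftSizes≤ : ∀ T i → i < size T → at (leftSizes T) i ≤ i
at-leftSizes≤ (node l r) i i<n with split (size l) (size r) i i<n
... | left p  = subst (_≤ i) (sym (at-leftSizes-left l r p)) (at-leftSizes≤ l i p)
... | root    = ≤-reflexive (at-leftSizes-root l r)
... | right {k} p = begin
  at (leftSizes (node l r)) (size l + suc k) ≡⟨ at-leftSizes-node l r (suc k) ⟩
  at (leftSizes r) k                         ≤⟨ at-leftSizes≤ r k p ⟩
  k                                          ≤⟨ n≤1+n k ⟩
  suc k                                      ≤⟨ m≤n+m (suc k) (size l) ⟩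
  size l + suc k                             ∎
  where open ≤-Reasoning

Agree : ℕ → ArcFn → ArcFn → Set
Agree n f g = ∀ i → i < n → f i ≡ g i

record IsNode (a b : ℕ) (f g h : ArcFn) : Set where
  field
    agree-left  : Agree a f g
    root-zero   : f a ≡ 0
    agree-right : ∀ k → k < b → f (a + suc k) ≡ a + suc (h k)

open IsNode

IsNode-cong : ∀ {a b f f′ g h} → Agree (a + suc b) f f′ → IsNode a b f g h → IsNode a b f′ g h
IsNode-cong {a} {b} f≈f′ N = record
  { agree-left  = λ i p → trans (sym (f≈f′ i (<-trans p (root<size a b)))) (agree-left N i p)
  ; root-zero   = trans (sym (f≈f′ a (root<size a b))) (root-zero N)
  ; agree-right = λ k p → trans (sym (f≈f′ _ (right<size a p))) (agree-right N k p)
  }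

hat-node : ∀ l r → IsNode (size l) (size r) (hat (node l r)) (hat l) (hat r)
hat-node l r = record
  { agree-left  = λ i p → cong (i ∸_) (at-leftSizes-left l r p)
  ; root-zero   = trans (cong (size l ∸_) (at-leftSizes-root l r)) (n∸n≡0 (size l))
  ; agree-right = λ k p → hat-right k (at-leftSizes≤ r k p)
  }
  where
  open ≡-Reasoning
  hat-right : ∀ k → at (leftSizes r) k ≤ k → hat (node l r) (size l + suc k) ≡ size l + suc (hat r k)
  hat-right k c≤k = begin
    size l + suc k ∸ at (leftSizes (node l r)) (size l + suc k) ≡⟨ cong (size l + suc k ∸_) (at-leftSizes-node l r (suc k)) ⟩
    size l + suc k ∸ at (leftSizes r) k                         ≡⟨ +-∸-assoc (size l) (m≤n⇒m≤1+n c≤k) ⟩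
    size l + (suc k ∸ at (leftSizes r) k)                       ≡⟨ cong (size l +_) (+-∸-assoc 1 c≤k) ⟩
    size l + suc (hat r k)                                      ∎

IsNode-agree : ∀ {a b f f′ g g′ h h′} → IsNode a b f g h → IsNode a b f′ g′ h′ →
  Agree a g g′ → Agree b h h′ → Agree (a + suc b) f f′
IsNode-agree {a} {b} N N′ g≈g′ h≈h′ i i<n with split a b i i<n
... | left p  = trans (agree-left N i p) (trans (g≈g′ i p) (sym (agree-left N′ i p)))
... | root    = trans (root-zero N) (sym (root-zero N′))
... | right {k} p =
  trans (agree-right N k p) (trans (cong (λ x → a + suc x) (h≈h′ k p)) (sym (agree-right N′ k p)))

IsNode-nonzero-beyond-root : ∀ {a b f g h j} → IsNode a b f g h → a < j → j < a + suc b → f j ≢ 0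
IsNode-nonzero-beyond-root {a} {b} {j = j} N a<j j<n with split a b j j<n
... | left p      = contradiction p (<⇒≯ a<j)
... | root        = contradiction a<j (<-irrefl refl)
... | right {k} p = m<n⇒n≢0 (root<size a _) ∘ trans (sym (agree-right N k p))

IsNode-unique : ∀ {a b a′ b′ f g h g′ h′} → IsNode a b f g h → IsNode a′ b′ f g′ h′ →
  a + suc b ≡ a′ + suc b′ → a ≡ a′ × b ≡ b′ × Agree a g g′ × Agree b h h′
IsNode-unique {a} {b} {a′} {b′} {f} {g} {h} N N′ n≡n′ = a≡a′ , b≡b′ , parts a≡a′ b≡b′ N′
  where
  a≡a′ : a ≡ a′
  a≡a′ with <-cmp a a′
  ... | tri< a<a′ _ _ = contradiction (root-zero N′)
                          (IsNode-nonzero-beyond-root N a<a′ (subst (a′ <_) (sym n≡n′) (root<size a′ b′)))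
  ... | tri≈ _ a≡a′ _ = a≡a′
  ... | tri> _ _ a′<a = contradiction (root-zero N)
                          (IsNode-nonzero-beyond-root N′ a′<a (subst (a <_) n≡n′ (root<size a b)))

  b≡b′ : b ≡ b′
  b≡b′ = suc-injective (+-cancelˡ-≡ a _ _ (trans n≡n′ (cong (_+ suc b′) (sym a≡a′))))

  parts : ∀ {a′ b′ g′ h′} → a ≡ a′ → b ≡ b′ → IsNode a′ b′ f g′ h′ → Agree a g g′ × Agree b h h′
  parts refl refl N′ =
    (λ i p → trans (sym (agree-left N i p)) (agree-left N′ i p)) ,
    (λ k p → suc-injective (+-cancelˡ-≡ a _ _ (trans (sym (agree-right N k p)) (agree-right N′ k p))))

+suc-cancel-< : ∀ a {x y} → a + suc x < a + suc y → x < y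
+suc-cancel-< a = s<s⁻¹ ∘ +-cancelˡ-< a _ _

+suc-cancel-≤ : ∀ a {x y} → a + suc x ≤ a + suc y → x ≤ y
+suc-cancel-≤ a = s≤s⁻¹ ∘ +-cancelˡ-≤ a _ _

IsNode-drawing : ∀ {a b f g h} → IsNode a b f g h → IsDrawing a g → IsDrawing b h → IsDrawing (a + suc b) f
IsNode-drawing {a} {b} {f} {g} {h} N (g-arc , g-nc) (h-arc , h-nc) = arc , noncrossing
  where
  right-arc : ∀ {k} → k < b → f (a + suc k) ≡ a + suc (h k)
  right-arc = agree-right N _

  root<right-arc : ∀ {k} → k < b → a < f (a + suc k)
  root<right-arc p = subst (a <_) (sym (right-arc p)) (root<size a _)

  arc : ∀ i → i < a + suc b → f i ≤ i
  arc i i<n with split a b i i<n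
  ... | left p      = subst (_≤ i) (sym (agree-left N i p)) (g-arc i p)
  ... | root        = subst (_≤ a) (sym (root-zero N)) z≤n
  ... | right {k} p = subst (_≤ a + suc k) (sym (right-arc p)) (+-monoʳ-≤ a (s≤s (h-arc k p)))

  noncrossing : ∀ i j → i < j → j < a + suc b → ¬ (f i < f j × f j ≤ i)
  noncrossing i j i<j j<n (fi<fj , fj≤i) with split a b j j<n
  ... | left q = g-nc i j i<j q
    ( subst₂ _<_ (agree-left N i (<-trans i<j q)) (agree-left N j q) fi<fj
    , subst (_≤ i) (agree-left N j q) fj≤i )
  ... | root = n≮0 (subst (f i <_) (root-zero N) fi<fj)
  ... | right {k} q with split a b i (<-trans i<j j<n)
  ...   | left p       = <⇒≱ (root<right-arc q) (≤-trans fj≤i (<⇒≤ p))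
  ...   | root         = <⇒≱ (root<right-arc q) fj≤i
  ...   | right {k′} p = h-nc k′ k (+suc-cancel-< a i<j) q
    ( +suc-cancel-< a (subst₂ _<_ (right-arc p) (right-arc q) fi<fj)
    , +suc-cancel-≤ a (subst (_≤ i) (right-arc q) fj≤i) )

IsNode-drawing⁻ : ∀ {a b f g h} → IsNode a b f g h → IsDrawing (a + suc b) f → IsDrawing a g × IsDrawing b h
IsNode-drawing⁻ {a} {b} {f} {g} {h} N (arc , noncrossing) = (g-arc , g-nc) , (h-arc , h-nc)
  where
  left<n : ∀ {i} → i < a → i < a + suc b
  left<n p = <-trans p (root<size a b)

  right-arc : ∀ {k} → k < b → f (a + suc k) ≡ a + suc (h k)
  right-arc = agree-right N _

  g-arc : ∀ i → i < a → g i ≤ i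
  g-arc i p = subst (_≤ i) (agree-left N i p) (arc i (left<n p))

  g-nc : ∀ i j → i < j → j < a → ¬ (g i < g j × g j ≤ i)
  g-nc i j i<j j<a (gi<gj , gj≤i) = noncrossing i j i<j (left<n j<a)
    ( subst₂ _<_ (sym (agree-left N i (<-trans i<j j<a))) (sym (agree-left N j j<a)) gi<gj
    , subst (_≤ i) (sym (agree-left N j j<a)) gj≤i )

  h-arc : ∀ k → k < b → h k ≤ k
  h-arc k p = +suc-cancel-≤ a (subst (_≤ a + suc k) (right-arc p) (arc _ (right<size a p)))

  h-nc : ∀ i j → i < j → j < b → ¬ (h i < h j × h j ≤ i)
  h-nc i j i<j j<b (hi<hj , hj≤i) = noncrossing _ _ (right<size a i<j) (right<size a j<b)
    ( subst₂ _<_ (sym (right-arc (<-trans i<j j<b))) (sym (right-arc j<b)) (right<size a hi<hj)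
    , subst (_≤ a + suc i) (sym (right-arc j<b)) (+-monoʳ-≤ a (s≤s hj≤i)) )

last-satisfying : ∀ {P : ℕ → Set} → Decidable P → P 0 →
  ∀ m → ∃ λ a → a ≤ m × P a × (∀ j → a < j → j ≤ m → ¬ P j)
last-satisfying P? P0 zero = 0 , z≤n , P0 , λ j 0<j j≤0 → contradiction j≤0 (<⇒≱ 0<j)
last-satisfying P? P0 (suc m) with P? (suc m) | last-satisfying P? P0 m
... | yes Pm | _ = suc m , ≤-refl , Pm , λ j m<j j≤m → contradiction j≤m (<⇒≱ m<j)
... | no ¬Pm | a , a≤m , Pa , none-after = a , m≤n⇒m≤1+n a≤m , Pa , none-after′
  where
  none-after′ : ∀ j → a < j → j ≤ suc m → ¬ _
  none-after′ j a<j j≤m with m≤n⇒m<n∨m≡n j≤m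
  ... | inj₁ j<m  = none-after j a<j (s≤s⁻¹ j<m)
  ... | inj₂ refl = ¬Pm

arc-beyond-zero-arc : ∀ {n f a j} → IsDrawing n f → f a ≡ 0 → a < j → j < n → f j ≢ 0 → a < f j
arc-beyond-zero-arc {f = f} (_ , noncrossing) fa≡0 a<j j<n fj≢0 = ≰⇒> λ fj≤a →
  noncrossing _ _ a<j j<n (subst (_< f _) (sym fa≡0) (n≢0⇒n>0 fj≢0) , fj≤a)

drawing-node : ∀ {m f} → IsDrawing (suc m) f → ∃₂ λ a b → a + suc b ≡ suc m × ∃ λ h → IsNode a b f f h
drawing-node {m} {f} D@(arc , _) with last-satisfying (λ i → f i ≟ 0) (n≤0⇒n≡0 (arc 0 z<s)) m
... | a , a≤m , fa≡0 , nonzero-after = a , m ∸ a , size≡ , h , record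
  { agree-left  = λ _ _ → refl
  ; root-zero   = fa≡0
  ; agree-right = right-arc
  }
  where
  size≡ : a + suc (m ∸ a) ≡ suc m
  size≡ = trans (+-suc a _) (cong suc (m+[n∸m]≡n a≤m))

  h : ArcFn
  h k = f (a + suc k) ∸ suc a

  right-arc : ∀ k → k < m ∸ a → f (a + suc k) ≡ a + suc (h k)
  right-arc k p = sym (trans (+-suc a (h k)) (m+[n∸m]≡n (arc-beyond-zero-arc D fa≡0 (root<size a k) j<n fj≢0)))
    where
    j<n : a + suc k < suc m
    j<n = subst (a + suc k <_) size≡ (right<size a p)
    fj≢0 : f (a + suc k) ≢ 0
    fj≢0 = nonzero-after _ (root<size a k) (s≤s⁻¹ j<n)

hat-drawing : ∀ T → IsDrawing (size T) (hat T)
hat-drawing leaf       = (λ _ ()) , λ _ _ _ ()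
hat-drawing (node l r) = IsNode-drawing (hat-node l r) (hat-drawing l) (hat-drawing r)

hat-injective : ∀ T T′ → size T ≡ size T′ → Agree (size T) (hat T) (hat T′) → T ≡ T′
hat-injective leaf       leaf         _ _ = refl
hat-injective leaf       (node l′ r′) e _ = contradiction (sym e) (m<n⇒n≢0 (root<size (size l′) (size r′)))
hat-injective (node l r) leaf         e _ = contradiction e (m<n⇒n≢0 (root<size (size l) (size r)))
hat-injective (node l r) (node l′ r′) e T≈T′
  with IsNode-unique (IsNode-cong T≈T′ (hat-node l r)) (hat-node l′ r′) e
... | l≡ , r≡ , l≈l′ , r≈r′ = cong₂ node (hat-injective l l′ l≡ l≈l′) (hat-injective r r′ r≡ r≈r′)

HatPreimage : ℕ → ArcFn → Set
HatPreimage n f = Σ Tree λ T → size T ≡ n × Agree n (hat T) f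

hat-surjective : ∀ n f → IsDrawing n f → HatPreimage n f
hat-surjective = <-rec _ step
  where
  step : ∀ n → (∀ {m} → m < n → ∀ f → IsDrawing m f → HatPreimage m f) → ∀ f → IsDrawing n f → HatPreimage n f
  step zero    _   f _ = leaf , refl , λ _ ()
  step (suc m) rec f D with drawing-node D
  ... | a , b , size≡ , h , N
    with IsNode-drawing⁻ N (subst (λ n → IsDrawing n f) (sym size≡) D)
  ... | DL , DR
    with rec (subst (a <_) size≡ (root<size a b)) f DL | rec (subst (b <_) size≡ (right-size<size a b)) h DR
  ... | L , refl , L≈ | R , refl , R≈ =
    node L R , size≡ , subst (λ n → Agree n (hat (node L R)) f) size≡ (IsNode-agree (hat-node L R) N L≈ R≈)

proposition2p6 : (n : ℕ) → 1 ≤ n →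
    ((T : Tree) → size T ≡ n → IsDrawing n (hat T))
    × ((T T′ : Tree) → size T ≡ n → size T′ ≡ n →
        ((i : ℕ) → i < n → hat T i ≡ hat T′ i) → T ≡ T′)
    × ((f : ArcFn) → IsDrawing n f →
        Σ Tree (λ T → size T ≡ n × ((i : ℕ) → i < n → hat T i ≡ f i)))
proposition2p6 n _ =
    (λ { T refl → hat-drawing T })
  , (λ { T T′ refl e′ → hat-injective T T′ (sym e′) })
  , hat-surjective n
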